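{- Let $S$ be a star graph with center node $c$ and let $L$ be a subset of the leaves of $S$. Let $\mathcal{G}$ be a DAG with skeleton $S$ and let $X=\mathrm{pa}_{\mathcal{G}}(c)$. Then $\mathbb{1}_{c\to L}(c_{\mathcal{G}})=1$ if $|X|\ge2$ and $X\cap L=\emptyset$, and $\mathbb{1}_{c\to L}(c_{\mathcal{G}})=0$ otherwise.
   Context: A star graph with center $c$ is a tree on at least $3$ nodes in which every node other than $c$ is a leaf. For a DAG $\mathcal{D}$ on a finite set $V$ and $A\subseteq V$, $c_{\mathcal{D}}(A)=1$ if some $a\in A$ has every $b\in A\setminus\{a\}$ as a parent in $\mathcal{D}$, and $0$ otherwise. The linear functional is $\mathbb{1}_{c\to L}(x)=\sum_{c\in A\subseteq V(S)\setminus L,\ |A|\ge3}\ \sum_{B\subseteq L}(-1)^{|A\cup B|-1}(|A|-2)\,x_{A\cup B}$. -}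

module Defs where

open import Data.Bool using (Bool; true; false; _∧_; _∨_; not; if_then_else_)
open import Data.Nat using (ℕ; zero; suc; _≤ᵇ_)
open import Data.Fin using (Fin; _≟_)
open import Data.Vec using (Vec; []; _∷_; lookup; tabulate)
open import Data.List using (List; []; _∷_; map; _++_; filter; allFin; foldr)
open import Data.Bool.ListAction using (any; all)
open import Data.Integer using (ℤ; +_; -_; _*_; _+_)
open import Data.Fin.Subset using (Subset; ∣_∣; _∪_)
open import Data.Product using (Σ; _×_; _,_)
open import Data.Sum using (_⊎_)
open import Relation.Binary.PropositionalEquality using (_≡_; _≢_)
open import Relation.Nullary using (¬_)
open import Relation.Nullary.Decidable using (⌊_⌋)

StarAdj : {n : ℕ} → Fin n → Fin n → Fin n → Set
StarAdj c u v = (u ≡ c × v ≢ c) ⊎ (v ≡ c × u ≢ c)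

-- A directed graph on Fin n: D u v ≡ true iff there is an arc u → v
-- (u is a parent of v).
Digraph : ℕ → Set
Digraph n = Fin n → Fin n → Bool

data Path {n : ℕ} (D : Digraph n) : Fin n → Fin n → Set where
  arc  : ∀ {u v} → D u v ≡ true → Path D u v
  _∷ᵖ_ : ∀ {u v w} → D u v ≡ true → Path D v w → Path D u w

Acyclic : {n : ℕ} → Digraph n → Set
Acyclic D = ∀ v → ¬ Path D v v

HasStarSkeleton : {n : ℕ} → Digraph n → Fin n → Set
HasStarSkeleton D c =
  ∀ u v → ((D u v ≡ true ⊎ D v u ≡ true) → StarAdj c u v)
        × (StarAdj c u v → (D u v ≡ true ⊎ D v u ≡ true))

parents : {n : ℕ} → Digraph n → Fin n → Subset n
parents D v = tabulate (λ u → D u v)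

eqᵇ : {n : ℕ} → Fin n → Fin n → Bool
eqᵇ a b = ⌊ a ≟ b ⌋

cD : {n : ℕ} → Digraph n → Subset n → ℤ
cD {n} D A =
  if any (λ a → lookup A a ∧
               all (λ b → not (lookup A b) ∨ eqᵇ b a ∨ D b a) (allFin n))
         (allFin n)
  then + 1 else + 0

allSubsets : (n : ℕ) → List (Subset n)
allSubsets zero    = [] ∷ []
allSubsets (suc n) = map (false ∷_) (allSubsets n) ++ map (true ∷_) (allSubsets n)

subsetᵇ : {n : ℕ} → Subset n → Subset n → Bool
subsetᵇ {n} A B = all (λ i → not (lookup A i) ∨ lookup B i) (allFin n)

compl : {n : ℕ} → Subset n → Subset n
compl A = Data.Vec.map not A

sumℤ : List ℤ → ℤ
sumℤ = foldr _+_ (+ 0)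

sign : ℕ → ℤ
sign zero          = + 1
sign (suc zero)    = - (+ 1)
sign (suc (suc k)) = sign k

-- 𝟙_{c→L}(x) = Σ_{c ∈ A ⊆ V ∖ L, |A| ≥ 3} Σ_{B ⊆ L}
--                 (-1)^{|A ∪ B| - 1} (|A| - 2) x_{A ∪ B}
-- (|A| ≥ 3 so |A| - 2 is a natural-number subtraction without truncation;
--  |A ∪ B| ≥ 3 so |A ∪ B| - 1 likewise.)
indicator : {n : ℕ} → Fin n → Subset n → (Subset n → ℤ) → ℤ
indicator {n} c L x =
  sumℤ (map (λ A →
          sumℤ (map (λ B →
                  sign (Data.Nat._∸_ ∣ A ∪ B ∣ 1) * (+ (Data.Nat._∸_ ∣ A ∣ 2)) * x (A ∪ B))
                (filter (λ B → subsetᵇ B L Data.Bool.≟ true) (allSubsets n))))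
        (filter (λ A → (lookup A c ∧ subsetᵇ A (compl L) ∧ (3 ≤ᵇ ∣ A ∣)) Data.Bool.≟ true)
                (allSubsets n)))

-- If c ∈ S and |S| ≥ 3, the star skeleton forces c_G(S) = [S ⊆ {c} ∪ X]: a leaf a ∈ S
-- cannot have all other nodes of S as parents, because S has a third node besides a
-- and c, and that node is not adjacent to a.  In a summand of 𝟙_{c→L}(c_G) the sets
-- A ⊆ V ∖ L and B ⊆ L are disjoint, so the summand factors as
-- w(|A|) [c ∈ A ⊆ ({c} ∪ X) ∖ L] · (-1)^|B| [B ⊆ X ∩ L], with w(k) = (-1)^(k-1) (k-2) [k ≥ 3].
-- The sum over B is Σₖ (|X ∩ L| choose k) (-1)^k = [X ∩ L = ∅].  When X ∩ L = ∅ the sum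
-- over A = {c} ∪ A', A' ⊆ X, is Σₖ (|X| choose k) w(k+1); the second difference of
-- k ↦ w(k+1) is the point mass at 0, so this is 1 if |X| ≥ 2 and 0 if |X| ≤ 1.
module Submission where

open import Defs
open import Data.Nat using (ℕ; _≤_)
open import Data.Fin using (Fin)
open import Data.Fin.Subset using (Subset; _∉_; ∣_∣; _∩_; Empty)
open import Data.Integer using (+_)
open import Data.Product using (_×_)
open import Relation.Binary.PropositionalEquality using (_≡_)
open import Relation.Nullary using (¬_)

import Algebra.Lattice.Properties.BooleanAlgebra as BooleanAlgebraProperties
import Algebra.Properties.CommutativeSemigroup as CommutativeSemigroupProperties
open import Data.Bool.Base using (Bool; true; false; _∧_; _∨_; not; if_then_else_; T)
import Data.Bool.Properties as Boolₚ
open import Data.Bool.ListAction using (and; all; any)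
open import Data.Empty using (⊥-elim)
open import Data.Fin.Base as Fin using (zero; suc)
open import Data.Fin.Properties using (_≟_; any?)
open import Data.Fin.Subset using (_∈_; _⊆_; _∪_; ∁; ⁅_⁆; ⊥; Nonempty)
open import Data.Fin.Subset.Properties
  using (_∈?_; x∈p∪q⁺; x∈p∪q⁻; x∈p∩q⁺; x∈p∩q⁻; x∈⁅x⁆; x∈⁅y⁆⇒x≡y; x∈∁p⇒x∉p; x∉p⇒x∈∁p;
         drop-∷-Empty; drop-not-there; ∪-identityˡ; ⊆-antisym; p∩q⊆q; Empty-unique; nonempty?;
         ⊥⊆; ∉⊥; ∣⊥∣≡0; ∣⁅x⁆∣≡1; ∣p∣≤∣x∷p∣; ∣p∣≤∣p∪q∣; p⊆q⇒∣p∣≤∣q∣; p⊂q⇒∣p∣<∣q∣)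
open import Data.Integer.Base using (ℤ; -_; _+_; _*_)
import Data.Integer.Properties as ℤₚ
open import Data.Integer.Tactic.RingSolver using (solve-∀)
open import Data.List.Base using ([]; _∷_; map; filter; allFin; _++_)
import Data.List.Properties as Listₚ
open import Data.List.Membership.Propositional.Properties using (∈-allFin)
import Data.List.Relation.Unary.All as All
import Data.List.Relation.Unary.Any as Any
open import Data.List.Relation.Unary.All.Properties using (all⁺)
open import Data.List.Relation.Unary.Any.Properties using (any⁺; any⁻)
open import Data.Nat.Base as ℕ using (zero; suc; _<_; _≤ᵇ_; _∸_; z≤n; s≤s)
import Data.Nat.Properties as ℕₚ
open import Data.Product using (∃; _,_; proj₁)
open import Data.Sum using (_⊎_; inj₁; inj₂; [_,_])
open import Data.Vec.Base using ([]; _∷_; lookup; here)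
import Data.Vec.Properties as Vecₚ
open import Function.Base using (_∘_; id; case_of_)
open import Function.Bundles using (Equivalence; mk⇔)
open import Relation.Binary.PropositionalEquality
  using (_≢_; refl; sym; trans; cong; cong₂; subst; module ≡-Reasoning)
open import Relation.Nullary.Decidable using (yes; no; ¬?; _×-dec_)

open BooleanAlgebraProperties Boolₚ.∨-∧-booleanAlgebra using (deMorgan₂)
open CommutativeSemigroupProperties ℤₚ.+-commutativeSemigroup using (interchange)

sumSubsets : (n : ℕ) → (Subset n → ℤ) → ℤ
sumSubsets zero    f = f []
sumSubsets (suc n) f = sumSubsets n (λ S → f (false ∷ S)) + sumSubsets n (λ S → f (true ∷ S))

sumSubsets-cong : ∀ {n} {f g : Subset n → ℤ} → (∀ S → f S ≡ g S) →
                  sumSubsets n f ≡ sumSubsets n g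
sumSubsets-cong {zero}  f≗g = f≗g []
sumSubsets-cong {suc n} f≗g =
  cong₂ _+_ (sumSubsets-cong (f≗g ∘ (false ∷_))) (sumSubsets-cong (f≗g ∘ (true ∷_)))

sumSubsets-zero : ∀ n → sumSubsets n (λ _ → + 0) ≡ + 0
sumSubsets-zero zero    = refl
sumSubsets-zero (suc n) = cong₂ _+_ (sumSubsets-zero n) (sumSubsets-zero n)

sumSubsets-*ˡ : ∀ {n} x (f : Subset n → ℤ) →
                sumSubsets n (λ S → x * f S) ≡ x * sumSubsets n f
sumSubsets-*ˡ {zero}  x f = refl
sumSubsets-*ˡ {suc n} x f =
  trans (cong₂ _+_ (sumSubsets-*ˡ x (f ∘ (false ∷_))) (sumSubsets-*ˡ x (f ∘ (true ∷_))))
        (sym (ℤₚ.*-distribˡ-+ x (sumSubsets n (f ∘ (false ∷_))) _))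

sumSubsets-*ʳ : ∀ {n} x (f : Subset n → ℤ) →
                sumSubsets n (λ S → f S * x) ≡ sumSubsets n f * x
sumSubsets-*ʳ {zero}  x f = refl
sumSubsets-*ʳ {suc n} x f =
  trans (cong₂ _+_ (sumSubsets-*ʳ x (f ∘ (false ∷_))) (sumSubsets-*ʳ x (f ∘ (true ∷_))))
        (sym (ℤₚ.*-distribʳ-+ x (sumSubsets n (f ∘ (false ∷_))) _))

sumℤ-++ : ∀ xs ys → sumℤ (xs ++ ys) ≡ sumℤ xs + sumℤ ys
sumℤ-++ []       ys = sym (ℤₚ.+-identityˡ _)
sumℤ-++ (x ∷ xs) ys = trans (cong (_+_ x) (sumℤ-++ xs ys)) (sym (ℤₚ.+-assoc x _ _))

sumℤ-filter : ∀ {A : Set} (p : A → Bool) (f : A → ℤ) xs →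
              sumℤ (map f (filter (λ x → p x Boolₚ.≟ true) xs))
              ≡ sumℤ (map (λ x → if p x then f x else + 0) xs)
sumℤ-filter p f []       = refl
sumℤ-filter p f (x ∷ xs) with p x
... | true  = cong (_+_ (f x)) (sumℤ-filter p f xs)
... | false = trans (sumℤ-filter p f xs) (sym (ℤₚ.+-identityˡ _))

sumℤ-allSubsets : ∀ n (f : Subset n → ℤ) → sumℤ (map f (allSubsets n)) ≡ sumSubsets n f
sumℤ-allSubsets zero    f = ℤₚ.+-identityʳ (f [])
sumℤ-allSubsets (suc n) f = begin
  sumℤ (map f (map (false ∷_) Sₙ ++ map (true ∷_) Sₙ))
    ≡⟨ cong sumℤ (Listₚ.map-++ f (map (false ∷_) Sₙ) _) ⟩
  sumℤ (map f (map (false ∷_) Sₙ) ++ map f (map (true ∷_) Sₙ))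
    ≡⟨ sumℤ-++ (map f (map (false ∷_) Sₙ)) _ ⟩
  sumℤ (map f (map (false ∷_) Sₙ)) + sumℤ (map f (map (true ∷_) Sₙ))
    ≡⟨ cong₂ _+_ (cong sumℤ (sym (Listₚ.map-∘ Sₙ))) (cong sumℤ (sym (Listₚ.map-∘ Sₙ))) ⟩
  sumℤ (map (λ S → f (false ∷ S)) Sₙ) + sumℤ (map (λ S → f (true ∷ S)) Sₙ)
    ≡⟨ cong₂ _+_ (sumℤ-allSubsets n _) (sumℤ-allSubsets n _) ⟩
  sumSubsets (suc n) f ∎
  where
  open ≡-Reasoning
  Sₙ = allSubsets n

sumℤ-filter-allSubsets : ∀ n (p : Subset n → Bool) (f : Subset n → ℤ) →
                         sumℤ (map f (filter (λ S → p S Boolₚ.≟ true) (allSubsets n)))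
                         ≡ sumSubsets n (λ S → if p S then f S else + 0)
sumℤ-filter-allSubsets n p f = trans (sumℤ-filter p f (allSubsets n)) (sumℤ-allSubsets n _)

-- binomialSum f m = Σₖ (m choose k) f k, computed by Pascal's rule.
binomialSum : (ℕ → ℤ) → ℕ → ℤ
binomialSum f zero    = f zero
binomialSum f (suc m) = binomialSum f m + binomialSum (f ∘ suc) m

binomialSum-cong : ∀ {f g : ℕ → ℤ} m → (∀ k → f k ≡ g k) → binomialSum f m ≡ binomialSum g m
binomialSum-cong zero    f≗g = f≗g 0
binomialSum-cong (suc m) f≗g = cong₂ _+_ (binomialSum-cong m f≗g) (binomialSum-cong m (f≗g ∘ suc))

binomialSum-+ : ∀ (f g : ℕ → ℤ) m →
                binomialSum (λ k → f k + g k) m ≡ binomialSum f m + binomialSum g m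
binomialSum-+ f g zero    = refl
binomialSum-+ f g (suc m) =
  trans (cong₂ _+_ (binomialSum-+ f g m) (binomialSum-+ (f ∘ suc) (g ∘ suc) m))
        (interchange (binomialSum f m) _ _ _)

binomialSum-suc : ∀ f m → binomialSum f (suc m) ≡ binomialSum (λ k → f k + f (suc k)) m
binomialSum-suc f m = sym (binomialSum-+ f (f ∘ suc) m)

binomialSum-zero : ∀ m → binomialSum (λ _ → + 0) m ≡ + 0
binomialSum-zero zero    = refl
binomialSum-zero (suc m) = cong₂ _+_ (binomialSum-zero m) (binomialSum-zero m)

sign-suc : ∀ k → sign (suc k) ≡ - sign k
sign-suc zero          = refl
sign-suc (suc zero)    = refl
sign-suc (suc (suc k)) = sign-suc k

sign-+ : ∀ m n → sign (m ℕ.+ n) ≡ sign m * sign n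
sign-+ zero    n = sym (ℤₚ.*-identityˡ (sign n))
sign-+ (suc m) n = begin
  sign (suc (m ℕ.+ n))  ≡⟨ sign-suc (m ℕ.+ n) ⟩
  - sign (m ℕ.+ n)      ≡⟨ cong -_ (sign-+ m n) ⟩
  - (sign m * sign n)   ≡⟨ ℤₚ.neg-distribˡ-* (sign m) (sign n) ⟩
  - sign m * sign n     ≡⟨ cong (_* sign n) (sym (sign-suc m)) ⟩
  sign (suc m) * sign n ∎
  where open ≡-Reasoning

binomialSum-sign : ∀ {m} → 0 < m → binomialSum sign m ≡ + 0
binomialSum-sign {suc m} _ = begin
  binomialSum sign (suc m)                      ≡⟨ binomialSum-suc sign m ⟩
  binomialSum (λ k → sign k + sign (suc k)) m   ≡⟨ binomialSum-cong m cancel ⟩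
  binomialSum (λ _ → + 0) m                     ≡⟨ binomialSum-zero m ⟩
  + 0                                           ∎
  where
  open ≡-Reasoning
  cancel : ∀ k → sign k + sign (suc k) ≡ + 0
  cancel k = trans (cong (_+_ (sign k)) (sign-suc k)) (ℤₚ.+-inverseʳ (sign k))

-- The coefficient (-1)^(k-1) (k-2) that 𝟙_{c→L} gives a set A with |A| = k ≥ 3.
sizeWeight : ℕ → ℤ
sizeWeight (suc (suc (suc k))) = sign k * + suc k
sizeWeight _                   = + 0

binomialSum-sizeWeight : ∀ {m} → 2 ≤ m → binomialSum (sizeWeight ∘ suc) m ≡ + 1
binomialSum-sizeWeight {suc (suc m)} (s≤s (s≤s _)) = begin
  binomialSum h (suc (suc m))                ≡⟨ binomialSum-suc h (suc m) ⟩
  binomialSum Δh (suc m)                     ≡⟨ binomialSum-suc Δh m ⟩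
  binomialSum (λ k → Δh k + Δh (suc k)) m    ≡⟨ binomialSum-cong m Δ²h≡δ ⟩
  binomialSum δ m                            ≡⟨ binomialSum-δ m ⟩
  + 1                                        ∎
  where
  open ≡-Reasoning
  h Δh δ : ℕ → ℤ
  h = sizeWeight ∘ suc
  Δh k = h k + h (suc k)
  δ zero    = + 1
  δ (suc _) = + 0

  binomialSum-δ : ∀ m → binomialSum δ m ≡ + 1
  binomialSum-δ zero    = refl
  binomialSum-δ (suc m) = cong₂ _+_ (binomialSum-δ m) (binomialSum-zero m)

  Δ²h≡δ : ∀ k → Δh k + Δh (suc k) ≡ δ k
  Δ²h≡δ zero          = refl
  Δ²h≡δ (suc zero)    = refl
  Δ²h≡δ (suc (suc j)) =
    trans (cong (λ s → (sign j * + suc j + s * + suc (suc j))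
                       + (s * + suc (suc j) + sign j * + suc (suc (suc j))))
                (sign-suc j))
          (vanishes (sign j) (+ j))
    where
    vanishes : ∀ s x → (s * (+ 1 + x) + - s * (+ 2 + x)) + (- s * (+ 2 + x) + s * (+ 3 + x)) ≡ + 0
    vanishes = solve-∀

binomialSum-sizeWeight-small : ∀ {m} → ¬ 2 ≤ m → binomialSum (sizeWeight ∘ suc) m ≡ + 0
binomialSum-sizeWeight-small {zero}        _   = refl
binomialSum-sizeWeight-small {suc zero}    _   = refl
binomialSum-sizeWeight-small {suc (suc m)} m≱2 = ⊥-elim (m≱2 (s≤s (s≤s z≤n)))

sizeWeight-split : ∀ a b (x y : Bool) → (3 ≤ᵇ a) ≡ true →
                   sign (a ℕ.+ b ∸ 1) * + (a ∸ 2) * (if x ∧ y then + 1 else + 0)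
                   ≡ (if x then sizeWeight a else + 0) * (if y then sign b else + 0)
sizeWeight-split (suc (suc (suc k))) b true  true  _ = begin
  sign (k ℕ.+ b) * + suc k * + 1  ≡⟨ ℤₚ.*-identityʳ _ ⟩
  sign (k ℕ.+ b) * + suc k        ≡⟨ cong (_* + suc k) (sign-+ k b) ⟩
  sign k * sign b * + suc k       ≡⟨ swap (sign k) (sign b) (+ suc k) ⟩
  sign k * + suc k * sign b       ∎
  where
  open ≡-Reasoning
  swap : ∀ s t x → s * t * x ≡ s * x * t
  swap = solve-∀
sizeWeight-split (suc (suc (suc k))) b true  false _ =
  trans (ℤₚ.*-zeroʳ (sign (k ℕ.+ b) * + suc k)) (sym (ℤₚ.*-zeroʳ (sign k * + suc k)))
sizeWeight-split (suc (suc (suc k))) b false y     _ = ℤₚ.*-zeroʳ (sign (k ℕ.+ b) * + suc k)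

sizeWeight-vanishes : ∀ x y z k → x ∧ y ∧ (3 ≤ᵇ k) ≡ false →
                      (if x ∧ (y ∧ z) then sizeWeight k else + 0) ≡ + 0
sizeWeight-vanishes false y     z k                   _  = refl
sizeWeight-vanishes true  false z k                   _  = refl
sizeWeight-vanishes true  true  z zero                _  = Boolₚ.if-eta z
sizeWeight-vanishes true  true  z (suc zero)          _  = Boolₚ.if-eta z
sizeWeight-vanishes true  true  z (suc (suc zero))    _  = Boolₚ.if-eta z
sizeWeight-vanishes true  true  z (suc (suc (suc k))) ()

private
  to-≡ : ∀ {b} → T b → b ≡ true
  to-≡ = Equivalence.to Boolₚ.T-≡

  from-≡ : ∀ {b} → b ≡ true → T b
  from-≡ = Equivalence.from Boolₚ.T-≡

all-cong : ∀ {A : Set} {f g : A → Bool} → (∀ x → f x ≡ g x) → ∀ xs → all f xs ≡ all g xs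
all-cong f≗g xs = cong and (Listₚ.map-cong f≗g xs)

all-∧ : ∀ {A : Set} (f g : A → Bool) xs → all (λ x → f x ∧ g x) xs ≡ all f xs ∧ all g xs
all-∧ f g []       = refl
all-∧ f g (x ∷ xs) with f x | g x
... | true  | true  = all-∧ f g xs
... | true  | false = sym (Boolₚ.∧-zeroʳ (all f xs))
... | false | _     = refl

all-allFin⁻ : ∀ {n} (p : Fin n → Bool) → all p (allFin n) ≡ true → ∀ i → p i ≡ true
all-allFin⁻ p all≡true i = to-≡ (All.lookup (all⁺ p (allFin _) (from-≡ all≡true)) (∈-allFin i))

any-allFin-single : ∀ {n} (p : Fin n → Bool) c → (∀ a → a ≢ c → p a ≡ false) →
                    any p (allFin n) ≡ p c
any-allFin-single p c off = Boolₚ.⇔→≡ (mk⇔ to from)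
  where
  to : any p (allFin _) ≡ true → p c ≡ true
  to any≡true with Any.satisfied (any⁻ p (allFin _) (from-≡ any≡true))
  ... | a , pa with a ≟ c
  ...   | yes refl = to-≡ pa
  ...   | no a≢c   = ⊥-elim (subst T (off a a≢c) pa)
  from : p c ≡ true → any p (allFin _) ≡ true
  from pc≡true = to-≡ (any⁺ p (Any.map (λ { refl → from-≡ pc≡true }) (∈-allFin c)))

eqᵇ-≢ : ∀ {n} {x y : Fin n} → x ≢ y → eqᵇ x y ≡ false
eqᵇ-≢ {x = x} {y} x≢y with x ≟ y
... | yes x≡y = ⊥-elim (x≢y x≡y)
... | no  _   = refl

lookup-⁅⁆ : ∀ {n} (x y : Fin n) → lookup ⁅ y ⁆ x ≡ eqᵇ x y
lookup-⁅⁆ zero    zero    = refl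
lookup-⁅⁆ zero    (suc y) = refl
lookup-⁅⁆ (suc x) zero    = Vecₚ.lookup-replicate x false
lookup-⁅⁆ (suc x) (suc y) = trans (lookup-⁅⁆ x y) (eqᵇ-suc x y)
  where
  eqᵇ-suc : ∀ {n} (x y : Fin n) → eqᵇ x y ≡ eqᵇ (suc x) (suc y)
  eqᵇ-suc x y with x ≟ y
  ... | yes _ = refl
  ... | no  _ = refl

subsetᵇ-∷ : ∀ {n} a b (p q : Subset n) → subsetᵇ (a ∷ p) (b ∷ q) ≡ (not a ∨ b) ∧ subsetᵇ p q
subsetᵇ-∷ {n} a b p q =
  cong ((not a ∨ b) ∧_)
       (cong and (trans (Listₚ.map-tabulate {n = n} Fin.suc _) (sym (Listₚ.map-tabulate id _))))

subsetᵇ-∪ˡ : ∀ {n} (p q r : Subset n) → subsetᵇ (p ∪ q) r ≡ subsetᵇ p r ∧ subsetᵇ q r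
subsetᵇ-∪ˡ {n} p q r = trans (all-cong pointwise (allFin n)) (all-∧ _ _ (allFin n))
  where
  pointwise : ∀ i → not (lookup (p ∪ q) i) ∨ lookup r i
                  ≡ (not (lookup p i) ∨ lookup r i) ∧ (not (lookup q i) ∨ lookup r i)
  pointwise i = begin
    not (lookup (p ∪ q) i) ∨ lookup r i
      ≡⟨ cong (λ b → not b ∨ lookup r i) (Vecₚ.lookup-zipWith _∨_ i p q) ⟩
    not (lookup p i ∨ lookup q i) ∨ lookup r i
      ≡⟨ cong (_∨ lookup r i) (deMorgan₂ (lookup p i) (lookup q i)) ⟩
    (not (lookup p i) ∧ not (lookup q i)) ∨ lookup r i
      ≡⟨ Boolₚ.∨-distribʳ-∧ (lookup r i) (not (lookup p i)) (not (lookup q i)) ⟩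
    (not (lookup p i) ∨ lookup r i) ∧ (not (lookup q i) ∨ lookup r i) ∎
    where open ≡-Reasoning

subsetᵇ-∩ʳ : ∀ {n} (p q r : Subset n) → subsetᵇ p (q ∩ r) ≡ subsetᵇ p q ∧ subsetᵇ p r
subsetᵇ-∩ʳ {n} p q r = trans (all-cong pointwise (allFin n)) (all-∧ _ _ (allFin n))
  where
  pointwise : ∀ i → not (lookup p i) ∨ lookup (q ∩ r) i
                  ≡ (not (lookup p i) ∨ lookup q i) ∧ (not (lookup p i) ∨ lookup r i)
  pointwise i = trans (cong (not (lookup p i) ∨_) (Vecₚ.lookup-zipWith _∧_ i q r))
                      (Boolₚ.∨-distribˡ-∧ (not (lookup p i)) _ _)

subsetᵇ⇒⊆ : ∀ {n} {p q : Subset n} → subsetᵇ p q ≡ true → p ⊆ q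
subsetᵇ⇒⊆ {p = p} {q} p⊆ᵇq {x} x∈p =
  Vecₚ.lookup⇒[]= x q (resolve (Vecₚ.[]=⇒lookup x∈p) (all-allFin⁻ _ p⊆ᵇq x))
  where
  resolve : ∀ {a b} → a ≡ true → not a ∨ b ≡ true → b ≡ true
  resolve refl b≡true = b≡true

∣p∪q∣≤∣p∣+∣q∣ : ∀ {n} (p q : Subset n) → ∣ p ∪ q ∣ ≤ ∣ p ∣ ℕ.+ ∣ q ∣
∣p∪q∣≤∣p∣+∣q∣ []          []          = z≤n
∣p∪q∣≤∣p∣+∣q∣ (true  ∷ p) (y     ∷ q) =
  s≤s (ℕₚ.≤-trans (∣p∪q∣≤∣p∣+∣q∣ p q) (ℕₚ.+-monoʳ-≤ ∣ p ∣ (∣p∣≤∣x∷p∣ y q)))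
∣p∪q∣≤∣p∣+∣q∣ (false ∷ p) (true  ∷ q) =
  ℕₚ.≤-trans (s≤s (∣p∪q∣≤∣p∣+∣q∣ p q)) (ℕₚ.≤-reflexive (sym (ℕₚ.+-suc ∣ p ∣ ∣ q ∣)))
∣p∪q∣≤∣p∣+∣q∣ (false ∷ p) (false ∷ q) = ∣p∪q∣≤∣p∣+∣q∣ p q

∣p∪q∣≡∣p∣+∣q∣ : ∀ {n} (p q : Subset n) → Empty (p ∩ q) → ∣ p ∪ q ∣ ≡ ∣ p ∣ ℕ.+ ∣ q ∣
∣p∪q∣≡∣p∣+∣q∣ []          []          _ = refl
∣p∪q∣≡∣p∣+∣q∣ (true  ∷ p) (true  ∷ q) e = ⊥-elim (e (zero , here))
∣p∪q∣≡∣p∣+∣q∣ (true  ∷ p) (false ∷ q) e = cong suc (∣p∪q∣≡∣p∣+∣q∣ p q (drop-∷-Empty e))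
∣p∪q∣≡∣p∣+∣q∣ (false ∷ p) (true  ∷ q) e =
  trans (cong suc (∣p∪q∣≡∣p∣+∣q∣ p q (drop-∷-Empty e))) (sym (ℕₚ.+-suc ∣ p ∣ ∣ q ∣))
∣p∪q∣≡∣p∣+∣q∣ (false ∷ p) (false ∷ q) e = ∣p∪q∣≡∣p∣+∣q∣ p q (drop-∷-Empty e)

∃-third-element : ∀ {n} {p : Subset n} → 3 ≤ ∣ p ∣ → ∀ x y → ∃ λ z → z ∈ p × z ≢ x × z ≢ y
∃-third-element {p = p} 3≤∣p∣ x y with any? (λ z → z ∈? p ×-dec ¬? (z ≟ x) ×-dec ¬? (z ≟ y))
... | yes found = found
... | no  none  = ⊥-elim (ℕₚ.<⇒≱ 3≤∣p∣ ∣p∣≤2)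
  where
  p⊆⁅x⁆∪⁅y⁆ : p ⊆ ⁅ x ⁆ ∪ ⁅ y ⁆
  p⊆⁅x⁆∪⁅y⁆ {z} z∈p with z ≟ x | z ≟ y
  ... | yes refl | _        = x∈p∪q⁺ (inj₁ (x∈⁅x⁆ z))
  ... | no _     | yes refl = x∈p∪q⁺ (inj₂ (x∈⁅x⁆ z))
  ... | no z≢x   | no z≢y   = ⊥-elim (none (z , z∈p , z≢x , z≢y))
  ∣p∣≤2 : ∣ p ∣ ≤ 2
  ∣p∣≤2 = begin
    ∣ p ∣                      ≤⟨ p⊆q⇒∣p∣≤∣q∣ p⊆⁅x⁆∪⁅y⁆ ⟩
    ∣ ⁅ x ⁆ ∪ ⁅ y ⁆ ∣          ≤⟨ ∣p∪q∣≤∣p∣+∣q∣ ⁅ x ⁆ ⁅ y ⁆ ⟩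
    ∣ ⁅ x ⁆ ∣ ℕ.+ ∣ ⁅ y ⁆ ∣    ≡⟨ cong₂ ℕ._+_ (∣⁅x⁆∣≡1 x) (∣⁅x⁆∣≡1 y) ⟩
    2                          ∎
    where open ℕₚ.≤-Reasoning

sumSubsets-⊆ : ∀ {n} (Z : Subset n) (f : ℕ → ℤ) →
               sumSubsets n (λ A → if subsetᵇ A Z then f ∣ A ∣ else + 0) ≡ binomialSum f ∣ Z ∣
sumSubsets-⊆         []      f = refl
sumSubsets-⊆ {suc n} (z ∷ Z) f =
  trans (cong₂ _+_ (sumSubsets-cong (λ A → cong (λ b → if b then f ∣ A ∣ else + 0)
                                                 (subsetᵇ-∷ false z A Z)))
                   (sumSubsets-cong (λ A → cong (λ b → if b then f (suc ∣ A ∣) else + 0)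
                                                 (subsetᵇ-∷ true z A Z))))
        (split z)
  where
  split : ∀ z → sumSubsets n (λ A → if subsetᵇ A Z then f ∣ A ∣ else + 0)
              + sumSubsets n (λ A → if z ∧ subsetᵇ A Z then f (suc ∣ A ∣) else + 0)
              ≡ binomialSum f ∣ z ∷ Z ∣
  split true  = cong₂ _+_ (sumSubsets-⊆ Z f) (sumSubsets-⊆ Z (f ∘ suc))
  split false = trans (cong₂ _+_ (sumSubsets-⊆ Z f) (sumSubsets-zero n)) (ℤₚ.+-identityʳ _)

sumSubsets-∋-⊆ : ∀ {n} (c : Fin n) (Z : Subset n) (f : ℕ → ℤ) → c ∉ Z →
                 sumSubsets n (λ A → if lookup A c ∧ subsetᵇ A (⁅ c ⁆ ∪ Z) then f ∣ A ∣ else + 0)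
                 ≡ binomialSum (f ∘ suc) ∣ Z ∣
sumSubsets-∋-⊆         zero    (true  ∷ Z) f c∉Z = ⊥-elim (c∉Z here)
sumSubsets-∋-⊆ {suc n} zero    (false ∷ Z) f _   =
  trans (cong₂ _+_ (sumSubsets-zero n) (sumSubsets-cong drop-head))
        (trans (ℤₚ.+-identityˡ _) (sumSubsets-⊆ Z (f ∘ suc)))
  where
  drop-head : ∀ A → (if subsetᵇ (true ∷ A) (true ∷ (⊥ ∪ Z)) then f (suc ∣ A ∣) else + 0)
                  ≡ (if subsetᵇ A Z then f (suc ∣ A ∣) else + 0)
  drop-head A = cong (λ b → if b then f (suc ∣ A ∣) else + 0)
                     (trans (subsetᵇ-∷ true true A (⊥ ∪ Z)) (cong (subsetᵇ A) (∪-identityˡ Z)))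
sumSubsets-∋-⊆ {suc n} (suc c) (z ∷ Z) f c∉z∷Z =
  trans (cong₂ _+_ (sumSubsets-cong (λ A → cong (λ b → if lookup A c ∧ b then f ∣ A ∣ else + 0)
                                                 (subsetᵇ-∷ false z A (⁅ c ⁆ ∪ Z))))
                   (sumSubsets-cong (λ A → cong (λ b → if lookup A c ∧ b then f (suc ∣ A ∣) else + 0)
                                                 (subsetᵇ-∷ true z A (⁅ c ⁆ ∪ Z)))))
        (split z)
  where
  c∉Z : c ∉ Z
  c∉Z = drop-not-there c∉z∷Z
  split : ∀ z → sumSubsets n (λ A → if lookup A c ∧ subsetᵇ A (⁅ c ⁆ ∪ Z) then f ∣ A ∣ else + 0)
              + sumSubsets n (λ A → if lookup A c ∧ (z ∧ subsetᵇ A (⁅ c ⁆ ∪ Z))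
                                      then f (suc ∣ A ∣) else + 0)
              ≡ binomialSum (f ∘ suc) ∣ z ∷ Z ∣
  split true  = cong₂ _+_ (sumSubsets-∋-⊆ c Z f c∉Z) (sumSubsets-∋-⊆ c Z (f ∘ suc) c∉Z)
  split false =
    trans (cong₂ _+_ (sumSubsets-∋-⊆ c Z f c∉Z)
                     (trans (sumSubsets-cong (λ A → cong (λ b → if b then f (suc ∣ A ∣) else + 0)
                                                         (Boolₚ.∧-zeroʳ (lookup A c))))
                            (sumSubsets-zero n)))
          (ℤₚ.+-identityʳ _)

module _ {n : ℕ} (G : Digraph n) where

  no-self-loop : Acyclic G → ∀ v → G v v ≡ false
  no-self-loop acyclic v with G v v in loop
  ... | false = refl
  ... | true  = ⊥-elim (acyclic v (arc loop))

  star-arc : ∀ {c u v} → HasStarSkeleton G c → G u v ≡ true → u ≡ c ⊎ v ≡ c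
  star-arc {c} {u} {v} star uv with proj₁ (star u v) (inj₁ uv)
  ... | inj₁ (u≡c , _) = inj₁ u≡c
  ... | inj₂ (v≡c , _) = inj₂ v≡c

  closedParents : Fin n → Subset n
  closedParents c = ⁅ c ⁆ ∪ parents G c

  lookup-parents : ∀ c b → lookup (parents G c) b ≡ G b c
  lookup-parents c = Vecₚ.lookup∘tabulate (λ u → G u c)

  lookup-closedParents : ∀ c b → lookup (closedParents c) b ≡ eqᵇ b c ∨ G b c
  lookup-closedParents c b =
    trans (Vecₚ.lookup-zipWith _∨_ b ⁅ c ⁆ (parents G c))
          (cong₂ _∨_ (lookup-⁅⁆ b c) (lookup-parents c b))

  cD-star : ∀ {c} → HasStarSkeleton G c → (S : Subset n) → lookup S c ≡ true → 3 ≤ ∣ S ∣ →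
            cD G S ≡ (if subsetᵇ S (closedParents c) then + 1 else + 0)
  cD-star {c} star S S∋c 3≤∣S∣ = cong (λ b → if b then + 1 else + 0) (begin
    any isSink (allFin n)
      ≡⟨ any-allFin-single isSink c non-centre ⟩
    lookup S c ∧ all (λ b → not (lookup S b) ∨ eqᵇ b c ∨ G b c) (allFin n)
      ≡⟨ cong (_∧ all (λ b → not (lookup S b) ∨ eqᵇ b c ∨ G b c) (allFin n)) S∋c ⟩
    all (λ b → not (lookup S b) ∨ eqᵇ b c ∨ G b c) (allFin n)
      ≡⟨ all-cong (λ b → cong (not (lookup S b) ∨_) (sym (lookup-closedParents c b))) (allFin n) ⟩
    subsetᵇ S (closedParents c) ∎)
    where
    open ≡-Reasoning
    isSink : Fin n → Bool
    isSink a = lookup S a ∧ all (λ b → not (lookup S b) ∨ eqᵇ b a ∨ G b a) (allFin n)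

    arc-into : ∀ {a b} → not (lookup S b) ∨ eqᵇ b a ∨ G b a ≡ true → b ∈ S → b ≢ a → G b a ≡ true
    arc-into all-b b∈S b≢a = resolve (Vecₚ.[]=⇒lookup b∈S) (eqᵇ-≢ b≢a) all-b
      where
      resolve : ∀ {s e g} → s ≡ true → e ≡ false → not s ∨ e ∨ g ≡ true → g ≡ true
      resolve refl refl g≡true = g≡true

    non-centre : ∀ a → a ≢ c → isSink a ≡ false
    non-centre a a≢c with isSink a in sink
    ... | false = refl
    ... | true with ∃-third-element 3≤∣S∣ a c
    ...   | b , b∈S , b≢a , b≢c =
      ⊥-elim ([ b≢c , a≢c ] (star-arc star (arc-into (all-allFin⁻ _ (Boolₚ.∧-conicalʳ _ _ sink) b) b∈S b≢a)))

module StarIndicator {n : ℕ} (c : Fin n) (L : Subset n) (G : Digraph n) (star : HasStarSkeleton G c) where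

  X W : Subset n
  X = parents G c
  W = closedParents G c

  -- The range of A in 𝟙_{c→L}; the compl of Defs is definitionally ∁.
  admissible : Subset n → Bool
  admissible A = lookup A c ∧ subsetᵇ A (∁ L) ∧ (3 ≤ᵇ ∣ A ∣)

  summand : Subset n → Subset n → ℤ
  summand A B = sign (∣ A ∪ B ∣ ∸ 1) * + (∣ A ∣ ∸ 2) * cD G (A ∪ B)

  factorA factorB : Subset n → ℤ
  factorA A = if lookup A c ∧ (subsetᵇ A (∁ L) ∧ subsetᵇ A W) then sizeWeight ∣ A ∣ else + 0
  factorB B = if subsetᵇ B L ∧ subsetᵇ B W then sign ∣ B ∣ else + 0

  indicator-sumSubsets :
    indicator c L (cD G)
    ≡ sumSubsets n (λ A → if admissible A
                            then sumSubsets n (λ B → if subsetᵇ B L then summand A B else + 0)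
                            else + 0)
  indicator-sumSubsets =
    trans (sumℤ-filter-allSubsets n admissible _)
          (sumSubsets-cong (λ A → cong (λ s → if admissible A then s else + 0)
                                       (sumℤ-filter-allSubsets n (λ B → subsetᵇ B L) (summand A))))

  summand-admissible : ∀ A B → lookup A c ≡ true → subsetᵇ A (∁ L) ≡ true → (3 ≤ᵇ ∣ A ∣) ≡ true →
                       subsetᵇ B L ≡ true →
                       summand A B ≡ (if subsetᵇ A W then sizeWeight ∣ A ∣ else + 0)
                                     * (if subsetᵇ B W then sign ∣ B ∣ else + 0)
  summand-admissible A B A∋c A⊆∁L 3≤ᵇ∣A∣ B⊆L = begin
    sign (∣ A ∪ B ∣ ∸ 1) * + (∣ A ∣ ∸ 2) * cD G (A ∪ B)
      ≡⟨ cong₂ (λ k d → sign (k ∸ 1) * + (∣ A ∣ ∸ 2) * d) ∣A∪B∣≡∣A∣+∣B∣ cD-A∪B ⟩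
    sign (∣ A ∣ ℕ.+ ∣ B ∣ ∸ 1) * + (∣ A ∣ ∸ 2) * (if subsetᵇ A W ∧ subsetᵇ B W then + 1 else + 0)
      ≡⟨ sizeWeight-split ∣ A ∣ ∣ B ∣ (subsetᵇ A W) (subsetᵇ B W) 3≤ᵇ∣A∣ ⟩
    (if subsetᵇ A W then sizeWeight ∣ A ∣ else + 0) * (if subsetᵇ B W then sign ∣ B ∣ else + 0) ∎
    where
    open ≡-Reasoning
    disjoint : Empty (A ∩ B)
    disjoint (x , x∈A∩B) with x∈p∩q⁻ A B x∈A∩B
    ... | x∈A , x∈B = x∈∁p⇒x∉p {p = L} (subsetᵇ⇒⊆ A⊆∁L x∈A) (subsetᵇ⇒⊆ B⊆L x∈B)
    ∣A∪B∣≡∣A∣+∣B∣ : ∣ A ∪ B ∣ ≡ ∣ A ∣ ℕ.+ ∣ B ∣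
    ∣A∪B∣≡∣A∣+∣B∣ = ∣p∪q∣≡∣p∣+∣q∣ A B disjoint
    A∪B∋c : lookup (A ∪ B) c ≡ true
    A∪B∋c = trans (Vecₚ.lookup-zipWith _∨_ c A B) (cong (_∨ lookup B c) A∋c)
    3≤∣A∪B∣ : 3 ≤ ∣ A ∪ B ∣
    3≤∣A∪B∣ = ℕₚ.≤-trans (ℕₚ.≤ᵇ⇒≤ 3 ∣ A ∣ (from-≡ 3≤ᵇ∣A∣)) (∣p∣≤∣p∪q∣ A B)
    cD-A∪B : cD G (A ∪ B) ≡ (if subsetᵇ A W ∧ subsetᵇ B W then + 1 else + 0)
    cD-A∪B = trans (cD-star G star (A ∪ B) A∪B∋c 3≤∣A∪B∣)
                   (cong (λ b → if b then + 1 else + 0) (subsetᵇ-∪ˡ A B W))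

  outer-summand-factorises :
    ∀ A → (if admissible A then sumSubsets n (λ B → if subsetᵇ B L then summand A B else + 0) else + 0)
          ≡ factorA A * sumSubsets n factorB
  outer-summand-factorises A with admissible A in A-ok
  ... | false = sym (cong (_* sumSubsets n factorB)
                          (sizeWeight-vanishes (lookup A c) (subsetᵇ A (∁ L)) (subsetᵇ A W) ∣ A ∣ A-ok))
  ... | true  = trans (sumSubsets-cong summand-factorises) (sumSubsets-*ˡ (factorA A) factorB)
    where
    A∋c : lookup A c ≡ true
    A∋c = Boolₚ.∧-conicalˡ _ _ A-ok
    A⊆∁L : subsetᵇ A (∁ L) ≡ true
    A⊆∁L = Boolₚ.∧-conicalˡ _ _ (Boolₚ.∧-conicalʳ (lookup A c) _ A-ok)
    3≤ᵇ∣A∣ : (3 ≤ᵇ ∣ A ∣) ≡ true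
    3≤ᵇ∣A∣ = Boolₚ.∧-conicalʳ (subsetᵇ A (∁ L)) _ (Boolₚ.∧-conicalʳ (lookup A c) _ A-ok)
    factorA-admissible : factorA A ≡ (if subsetᵇ A W then sizeWeight ∣ A ∣ else + 0)
    factorA-admissible = cong (λ b → if b then sizeWeight ∣ A ∣ else + 0)
                              (cong₂ (λ x y → x ∧ (y ∧ subsetᵇ A W)) A∋c A⊆∁L)
    summand-factorises : ∀ B → (if subsetᵇ B L then summand A B else + 0) ≡ factorA A * factorB B
    summand-factorises B with subsetᵇ B L in B⊆L
    ... | false = sym (ℤₚ.*-zeroʳ (factorA A))
    ... | true  = trans (summand-admissible A B A∋c A⊆∁L 3≤ᵇ∣A∣ B⊆L)
                        (cong (_* _) (sym factorA-admissible))

  indicator-factorises : indicator c L (cD G) ≡ sumSubsets n factorA * sumSubsets n factorB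
  indicator-factorises = trans indicator-sumSubsets
    (trans (sumSubsets-cong outer-summand-factorises) (sumSubsets-*ʳ (sumSubsets n factorB) factorA))

  L∩W≡X∩L : c ∉ L → L ∩ W ≡ X ∩ L
  L∩W≡X∩L c∉L = ⊆-antisym L∩W⊆X∩L X∩L⊆L∩W
    where
    L∩W⊆X∩L : L ∩ W ⊆ X ∩ L
    L∩W⊆X∩L x∈L∩W with x∈p∩q⁻ L W x∈L∩W
    ... | x∈L , x∈W with x∈p∪q⁻ ⁅ c ⁆ X x∈W
    ...   | inj₁ x∈⁅c⁆ = ⊥-elim (c∉L (subst (_∈ L) (x∈⁅y⁆⇒x≡y c x∈⁅c⁆) x∈L))
    ...   | inj₂ x∈X   = x∈p∩q⁺ (x∈X , x∈L)
    X∩L⊆L∩W : X ∩ L ⊆ L ∩ W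
    X∩L⊆L∩W x∈X∩L with x∈p∩q⁻ X L x∈X∩L
    ... | x∈X , x∈L = x∈p∩q⁺ (x∈L , x∈p∪q⁺ (inj₂ x∈X))

  ∁L∩W≡W : c ∉ L → Empty (X ∩ L) → ∁ L ∩ W ≡ W
  ∁L∩W≡W c∉L X∩L-empty = ⊆-antisym (p∩q⊆q (∁ L) W) (λ x∈W → x∈p∩q⁺ (W⊆∁L x∈W , x∈W))
    where
    W⊆∁L : W ⊆ ∁ L
    W⊆∁L {x} x∈W with x∈p∪q⁻ ⁅ c ⁆ X x∈W
    ... | inj₁ x∈⁅c⁆ = x∉p⇒x∈∁p (subst (_∉ L) (sym (x∈⁅y⁆⇒x≡y c x∈⁅c⁆)) c∉L)
    ... | inj₂ x∈X   = x∉p⇒x∈∁p (λ x∈L → X∩L-empty (x , x∈p∩q⁺ (x∈X , x∈L)))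

  sum-factorB : c ∉ L → sumSubsets n factorB ≡ binomialSum sign ∣ X ∩ L ∣
  sum-factorB c∉L =
    trans (sumSubsets-cong (λ B → cong (λ b → if b then sign ∣ B ∣ else + 0)
                                       (trans (sym (subsetᵇ-∩ʳ B L W)) (cong (subsetᵇ B) (L∩W≡X∩L c∉L)))))
          (sumSubsets-⊆ (X ∩ L) sign)

  sum-factorA : Acyclic G → c ∉ L → Empty (X ∩ L) →
                sumSubsets n factorA ≡ binomialSum (sizeWeight ∘ suc) ∣ X ∣
  sum-factorA acyclic c∉L X∩L-empty =
    trans (sumSubsets-cong (λ A → cong (λ b → if lookup A c ∧ b then sizeWeight ∣ A ∣ else + 0)
                                       (trans (sym (subsetᵇ-∩ʳ A (∁ L) W))
                                              (cong (subsetᵇ A) (∁L∩W≡W c∉L X∩L-empty)))))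
          (sumSubsets-∋-⊆ c X sizeWeight c∉X)
    where
    c∉X : c ∉ X
    c∉X c∈X with trans (sym (Vecₚ.[]=⇒lookup c∈X)) (trans (lookup-parents G c c) (no-self-loop G acyclic c))
    ... | ()

  indicator-X∩L-empty : Acyclic G → c ∉ L → Empty (X ∩ L) →
                        indicator c L (cD G) ≡ binomialSum (sizeWeight ∘ suc) ∣ X ∣
  indicator-X∩L-empty acyclic c∉L X∩L-empty = begin
    indicator c L (cD G)
      ≡⟨ indicator-factorises ⟩
    sumSubsets n factorA * sumSubsets n factorB
      ≡⟨ cong₂ _*_ (sum-factorA acyclic c∉L X∩L-empty) (sum-factorB c∉L) ⟩
    binomialSum (sizeWeight ∘ suc) ∣ X ∣ * binomialSum sign ∣ X ∩ L ∣
      ≡⟨ cong (λ k → binomialSum (sizeWeight ∘ suc) ∣ X ∣ * binomialSum sign k) ∣X∩L∣≡0 ⟩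
    binomialSum (sizeWeight ∘ suc) ∣ X ∣ * + 1
      ≡⟨ ℤₚ.*-identityʳ _ ⟩
    binomialSum (sizeWeight ∘ suc) ∣ X ∣ ∎
    where
    open ≡-Reasoning
    ∣X∩L∣≡0 : ∣ X ∩ L ∣ ≡ 0
    ∣X∩L∣≡0 = trans (cong ∣_∣ (Empty-unique X∩L-empty)) (∣⊥∣≡0 n)

  indicator-X∩L-nonempty : c ∉ L → Nonempty (X ∩ L) → indicator c L (cD G) ≡ + 0
  indicator-X∩L-nonempty c∉L (x , x∈X∩L) = begin
    indicator c L (cD G)                          ≡⟨ indicator-factorises ⟩
    sumSubsets n factorA * sumSubsets n factorB   ≡⟨ cong (sumSubsets n factorA *_)
                                                          (trans (sum-factorB c∉L) (binomialSum-sign 0<∣X∩L∣)) ⟩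
    sumSubsets n factorA * + 0                    ≡⟨ ℤₚ.*-zeroʳ (sumSubsets n factorA) ⟩
    + 0                                           ∎
    where
    open ≡-Reasoning
    0<∣X∩L∣ : 0 < ∣ X ∩ L ∣
    0<∣X∩L∣ = subst (_< ∣ X ∩ L ∣) (∣⊥∣≡0 n) (p⊂q⇒∣p∣<∣q∣ (⊥⊆ , x , x∈X∩L , ∉⊥))

proposition5p12 : (n : ℕ) → 3 ≤ n → (c : Fin n) → (L : Subset n) → c ∉ L →
    (G : Digraph n) → Acyclic G → HasStarSkeleton G c →
    ((2 ≤ ∣ parents G c ∣ × Empty (parents G c ∩ L)) → indicator c L (cD G) ≡ + 1)
    × (¬ (2 ≤ ∣ parents G c ∣ × Empty (parents G c ∩ L)) → indicator c L (cD G) ≡ + 0)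
proposition5p12 n _ c L c∉L G acyclic star =
    (λ (2≤∣X∣ , X∩L-empty) →
       trans (indicator-X∩L-empty acyclic c∉L X∩L-empty) (binomialSum-sizeWeight 2≤∣X∣))
  , λ ¬condition → case nonempty? (X ∩ L) of λ where
      (yes X∩L-nonempty) → indicator-X∩L-nonempty c∉L X∩L-nonempty
      (no  X∩L-empty)    → trans (indicator-X∩L-empty acyclic c∉L X∩L-empty)
                                 (binomialSum-sizeWeight-small (λ 2≤∣X∣ → ¬condition (2≤∣X∣ , X∩L-empty)))
  where open StarIndicator c L G star
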